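{- Let $K$ be a finite Eulerian poset with minimum $\hat 0$ and rank function $\rho$, and let $P\in\mathrm{Or}(K)$ be a special projection. Then the induced subposet $(K\setminus \mathrm{Im}(P))\cup\{\hat 0\}$ of $K$ is graded with rank function (the restriction of) $\rho$.
   Context: A finite poset $K$ is graded if it has a minimum $\hat 0$, a maximum $\hat 1$ and a rank function $\rho:K\to\mathbb N$ ($\rho(y)=\rho(x)+1$ whenever $y$ covers $x$, written $x\vartriangleleft y$); it is Eulerian if moreover $\mu_K(x,y)=(-1)^{\rho(y)-\rho(x)}$ for all $x\leqslant y$. $\mathrm{Or}(K)$ is the monoid under composition of order preserving regressive ($f(x)\leqslant x$) maps $K\to K$. A matching of $K$ is a map $M:K\to K$ with $M\circ M=\mathrm{id}_K$ and, for all $x$, $M(x)\vartriangleleft x$ or $x\vartriangleleft M(x)$; it is special if $x\vartriangleleft y$ and $x\neq M(y)$ imply $M(x)\leqslant M(y)$. For a special matching $M$, $P^M:K\to K$ is $P^M(x)=x$ if $x\vartriangleleft M(x)$ and $P^M(x)=M(x)$ if $M(x)\vartriangleleft x$. $M^K$ is the submonoid of $\mathrm{Or}(K)$ generated by $\mathrm{id}_K$ and all $P^M$, $M$ a special matching of $K$. For $f:K\to K$, $f_y:=\{x:f(x)=y\}$. An idempotent $P\in\mathrm{Or}(K)$ is a projection if for all $x,y\in\mathrm{Im}(P)$ with $x\leqslant y$ the set $[x,y]\cap P_x$ is an interval of $K$. A special projection is a projection belonging to $M^K$. -}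

module Defs where

open import Data.Nat using (ℕ; zero; suc; _∸_)
open import Data.Integer using (ℤ; 0ℤ; 1ℤ; -1ℤ; _^_) renaming (_+_ to _+ℤ_)
open import Data.Fin using (Fin; zero; suc)
open import Data.Product using (Σ; ∃; _×_; _,_)
open import Data.Sum using (_⊎_)
open import Data.Unit using (⊤)
open import Function using (_∘_; id)
open import Relation.Nullary using (¬_; Dec; yes; no)
open import Relation.Binary using (Decidable; IsPartialOrder)
open import Relation.Binary.PropositionalEquality using (_≡_; _≢_)

record FinPoset : Set₁ where
  field
    n              : ℕ
    _≤_            : Fin n → Fin n → Set
    isPartialOrder : IsPartialOrder _≡_ _≤_
    _≤?_           : Decidable _≤_

module _ (K : FinPoset) where
  open FinPoset K

  Elt : Set
  Elt = Fin n

  _<_ : Elt → Elt → Set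
  x < y = (x ≤ y) × (x ≢ y)

  _⋖_ : Elt → Elt → Set
  x ⋖ y = (x < y) × ¬ (Σ Elt λ z → (x < z) × (z < y))

  IsMinimum : Elt → Set
  IsMinimum m = ∀ x → m ≤ x

  Subset : Set₁
  Subset = Elt → Set

  CoversIn : Subset → Elt → Elt → Set
  CoversIn S x y = (x < y) × ¬ (Σ Elt λ z → S z × (x < z) × (z < y))

  GradedOn : Subset → (Elt → ℕ) → Set
  GradedOn S ρ =
    (Σ Elt λ b → S b × (∀ z → S z → b ≤ z)) ×
    (Σ Elt λ t → S t × (∀ z → S z → z ≤ t)) ×
    (∀ x y → S x → S y → CoversIn S x y → ρ y ≡ suc (ρ x))

  Graded : (Elt → ℕ) → Set
  Graded ρ = GradedOn (λ _ → ⊤) ρ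

  ∑ : (m : ℕ) → (Fin m → ℤ) → ℤ
  ∑ zero    f = 0ℤ
  ∑ (suc m) f = f zero +ℤ ∑ m (f ∘ suc)

  inInterval : Elt → Elt → Elt → ℤ → ℤ
  inInterval x y z v with x ≤? z | z ≤? y
  ... | yes _ | yes _ = v
  ... | _     | _     = 0ℤ

  IsMobius : (Elt → Elt → ℤ) → Set
  IsMobius μ =
    (∀ x → μ x x ≡ 1ℤ) ×
    (∀ x y → ¬ (x ≤ y) → μ x y ≡ 0ℤ) ×
    (∀ x y → x < y → ∑ n (λ z → inInterval x y z (μ x z)) ≡ 0ℤ)

  Eulerian : (Elt → ℕ) → Set
  Eulerian ρ = Graded ρ ×
    (∀ μ → IsMobius μ → ∀ x y → x ≤ y → μ x y ≡ -1ℤ ^ (ρ y ∸ ρ x))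

  InOr : (Elt → Elt) → Set
  InOr f = (∀ x y → x ≤ y → f x ≤ f y) × (∀ x → f x ≤ x)

  IsMatching : (Elt → Elt) → Set
  IsMatching M = (∀ x → M (M x) ≡ x) × (∀ x → (M x ⋖ x) ⊎ (x ⋖ M x))

  IsSpecialMatching : (Elt → Elt) → Set
  IsSpecialMatching M =
    IsMatching M × (∀ x y → x ⋖ y → x ≢ M y → M x ≤ M y)

  -- P^M(x) = x if x ⋖ M(x), M(x) if M(x) ⋖ x.  For a matching, x and M x are
  -- comparable and distinct, so this is decided by testing x ≤ M x.
  PM : (Elt → Elt) → Elt → Elt
  PM M x with x ≤? M x
  ... | yes _ = x
  ... | no  _ = M x

  data Generated : (Elt → Elt) → Set where
    gen-id   : Generated id
    gen-step : ∀ {M f} → IsSpecialMatching M → Generated f → Generated (PM M ∘ f)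

  InMK : (Elt → Elt) → Set
  InMK P = Σ (Elt → Elt) λ f → Generated f × (∀ x → P x ≡ f x)

  Im : (Elt → Elt) → Subset
  Im P y = Σ Elt λ x → P x ≡ y

  Fiber : (Elt → Elt) → Elt → Subset
  Fiber P y x = P x ≡ y

  IsInterval : Subset → Set
  IsInterval S = Σ Elt λ a → Σ Elt λ b → (a ≤ b) ×
    (∀ z → (S z → (a ≤ z) × (z ≤ b)) × ((a ≤ z) × (z ≤ b) → S z))

  IsProjection : (Elt → Elt) → Set
  IsProjection P = InOr P × (∀ x → P (P x) ≡ P x) ×
    (∀ x y → Im P x → Im P y → x ≤ y →
       IsInterval (λ z → ((x ≤ z) × (z ≤ y)) × Fiber P x z))

  IsSpecialProjection : (Elt → Elt) → Set
  IsSpecialProjection P = IsProjection P × InMK P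

  ComplementWithBottom : (Elt → Elt) → Elt → Subset
  ComplementWithBottom P z0 z = (¬ Im P z) ⊎ (z ≡ z0)

-- If y covers x in S = (K ∖ Im P) ∪ {0̂}, every w strictly between them lies in Im P,
-- so w = P w ≤ P y < y. Hence if x ⋖ y fails in K, then x ≤ P y; x = P y is absurd,
-- and x < P y makes P y the maximum of the open interval (x, y), which forces
-- μ(x, y) = 0 and so cannot happen in an Eulerian poset. The maximum of S is the top
-- of K, unless P fixes the top; but a nonempty composite of maps P^M moves the top, so
-- then P = id and S = {0̂}.
module Submission where

open import Defs
open import Data.Nat as ℕ using (ℕ; zero; suc; s≤s)
import Data.Nat.Properties as ℕ using (≤-refl; <-≤-trans)
open import Data.Fin using (Fin; zero; suc)
open import Data.Fin.Properties using (_≟_; punchInᵢ≢i)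
open import Data.Fin.Subset as Finset using (_∈_; _⊂_; ∣_∣)
open import Data.Fin.Subset.Properties using (p⊂q⇒∣p∣<∣q∣)
open import Data.Integer using (ℤ; 0ℤ; 1ℤ; -1ℤ; -_; _+_; _^_)
open import Data.Integer.Properties
  using (+-0-commutativeMonoid; +-identityʳ; +-identityˡ; +-inverseˡ; i^n≡0⇒i≡0)
open import Algebra.Properties.CommutativeMonoid.Sum +-0-commutativeMonoid
  using (sum; sum-cong-≗; ∑-distrib-+; sum-remove; sum-replicate-zero)
open import Data.Vec using (tabulate)
open import Data.Vec.Properties using (lookup∘tabulate; []=⇒lookup; lookup⇒[]=)
open import Data.Product using (Σ; _×_; _,_; proj₁)
open import Data.Sum using (inj₁; inj₂; [_,_])
open import Data.Unit using (⊤; tt)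
open import Data.Empty using (⊥-elim)
open import Function using (_∘_; id)
open import Relation.Nullary using (¬_; yes; no; does)
open import Relation.Nullary.Decidable using (dec-true; _×-dec_)
open import Relation.Binary using (IsPartialOrder)
open import Relation.Binary.PropositionalEquality
  using (_≡_; _≢_; refl; sym; trans; cong; subst; module ≡-Reasoning)

open ≡-Reasoning

∑≡sum : (K : FinPoset) (m : ℕ) (f : Fin m → ℤ) → ∑ K m f ≡ sum f
∑≡sum K zero    f = refl
∑≡sum K (suc m) f = cong (f zero +_) (∑≡sum K m (f ∘ suc))

sum-single : ∀ {m} (f : Fin m → ℤ) (y : Fin m) → (∀ i → i ≢ y → f i ≡ 0ℤ) → sum f ≡ f y
sum-single {zero}  f ()
sum-single {suc m} f y f≡0 = begin
  sum f                    ≡⟨ sum-remove {i = y} f ⟩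
  f y + sum (f ∘ punchIn)  ≡⟨ cong (f y +_) rest≡0 ⟩
  f y + 0ℤ                 ≡⟨ +-identityʳ (f y) ⟩
  f y                      ∎
  where
  punchIn = Data.Fin.punchIn y
  rest≡0 : sum (f ∘ punchIn) ≡ 0ℤ
  rest≡0 = trans (sum-cong-≗ (λ j → f≡0 (punchIn j) (punchInᵢ≢i y j))) (sum-replicate-zero m)

module _ (K : FinPoset) where
  open FinPoset K
  open IsPartialOrder isPartialOrder using (reflexive; antisym)
    renaming (refl to ≤-refl; trans to ≤-trans)

  infix 4 _⊏_
  _⊏_ : Elt K → Elt K → Set
  _⊏_ = _<_ K

  ⊏-≤-trans : ∀ {x y z} → x ⊏ y → y ≤ z → y ≢ z → x ⊏ z
  ⊏-≤-trans (x≤y , _) y≤z y≢z = ≤-trans x≤y y≤z , λ { refl → y≢z (antisym y≤z x≤y) }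

  inInterval-∈ : ∀ {x y z} v → x ≤ z → z ≤ y → inInterval K x y z v ≡ v
  inInterval-∈ {x} {y} {z} v x≤z z≤y with x ≤? z | z ≤? y
  ... | yes _ | yes _  = refl
  ... | yes _ | no z≰y = ⊥-elim (z≰y z≤y)
  ... | no x≰z | _     = ⊥-elim (x≰z x≤z)

  inInterval-∉ : ∀ {x y z} v → ¬ (x ≤ z × z ≤ y) → inInterval K x y z v ≡ 0ℤ
  inInterval-∉ {x} {y} {z} v z∉ with x ≤? z | z ≤? y
  ... | yes x≤z | yes z≤y = ⊥-elim (z∉ (x≤z , z≤y))
  ... | yes _   | no _    = refl
  ... | no _    | _       = refl

  inInterval-cong : ∀ {x y x′ y′ z} v →
    (x ≤ z × z ≤ y → x′ ≤ z × z ≤ y′) → (x′ ≤ z × z ≤ y′ → x ≤ z × z ≤ y) →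
    inInterval K x y z v ≡ inInterval K x′ y′ z v
  inInterval-cong {x} {y} {x′} {y′} {z} v to from with x ≤? z ×-dec z ≤? y
  ... | yes (x≤z , z≤y) = let (x′≤z , z≤y′) = to (x≤z , z≤y) in
    trans (inInterval-∈ v x≤z z≤y) (sym (inInterval-∈ v x′≤z z≤y′))
  ... | no z∉ = trans (inInterval-∉ v z∉) (sym (inInterval-∉ v (z∉ ∘ from)))

  inHalfOpen : Elt K → Elt K → Elt K → ℤ → ℤ
  inHalfOpen x y z v with z ≟ y
  ... | yes _ = 0ℤ
  ... | no _  = inInterval K x y z v

  inHalfOpen-cong : ∀ {x y z a b} → (z ⊏ y → a ≡ b) → inHalfOpen x y z a ≡ inHalfOpen x y z b
  inHalfOpen-cong {x} {y} {z} {a} {b} a≡b with z ≟ y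
  ... | yes _  = refl
  ... | no z≢y with x ≤? z | z ≤? y
  ...   | yes _ | yes z≤y = a≡b (z≤y , z≢y)
  ...   | yes _ | no _    = refl
  ...   | no _  | _       = refl

  sum-interval-split : ∀ {x y} (f : Elt K → ℤ) → x ≤ y →
    sum (λ z → inInterval K x y z (f z)) ≡ f y + sum (λ z → inHalfOpen x y z (f z))
  sum-interval-split {x} {y} f x≤y = begin
    sum (λ z → inInterval K x y z (f z))                 ≡⟨ sum-cong-≗ split ⟩
    sum (λ z → atTop z + inHalfOpen x y z (f z))         ≡⟨ ∑-distrib-+ atTop _ ⟩
    sum atTop + sum (λ z → inHalfOpen x y z (f z))       ≡⟨ cong (_+ _) (sum-single atTop y atTop≡0) ⟩
    atTop y + sum (λ z → inHalfOpen x y z (f z))          ≡⟨ cong (_+ _) atTop-y ⟩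
    f y + sum (λ z → inHalfOpen x y z (f z))              ∎
    where
    atTop : Elt K → ℤ
    atTop z with z ≟ y
    ... | yes _ = f y
    ... | no _  = 0ℤ
    atTop-y : atTop y ≡ f y
    atTop-y with y ≟ y
    ... | yes _   = refl
    ... | no y≢y  = ⊥-elim (y≢y refl)
    atTop≡0 : ∀ z → z ≢ y → atTop z ≡ 0ℤ
    atTop≡0 z z≢y with z ≟ y
    ... | yes z≡y = ⊥-elim (z≢y z≡y)
    ... | no _    = refl
    split : ∀ z → inInterval K x y z (f z) ≡ atTop z + inHalfOpen x y z (f z)
    split z with z ≟ y
    ... | yes refl = trans (inInterval-∈ (f y) x≤y ≤-refl) (sym (+-identityʳ (f y)))
    ... | no _     = sym (+-identityˡ _)

  downset : Elt K → Finset.Subset n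
  downset y = tabulate (λ w → does (w ≤? y))

  ∈-downset⁺ : ∀ {w y} → w ≤ y → w ∈ downset y
  ∈-downset⁺ {w} {y} w≤y = lookup⇒[]= w _ (trans (lookup∘tabulate _ w) (dec-true (w ≤? y) w≤y))

  ∈-downset⁻ : ∀ {w y} → w ∈ downset y → w ≤ y
  ∈-downset⁻ {w} {y} w∈↓y with w ≤? y | trans (sym (lookup∘tabulate _ w)) ([]=⇒lookup w∈↓y)
  ... | yes w≤y | _ = w≤y
  ... | no _    | ()

  downset-⊂ : ∀ {z y} → z ⊏ y → downset z ⊂ downset y
  downset-⊂ (z≤y , z≢y) =
    (λ w∈↓z → ∈-downset⁺ (≤-trans (∈-downset⁻ w∈↓z) z≤y)) ,
    _ , ∈-downset⁺ ≤-refl , λ y∈↓z → z≢y (antisym z≤y (∈-downset⁻ y∈↓z))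

  height : Elt K → ℕ
  height y = ∣ downset y ∣

  height-mono : ∀ {z y} → z ⊏ y → height z ℕ.< height y
  height-mono = p⊂q⇒∣p∣<∣q∣ ∘ downset-⊂

  -- Eulerian K ρ only speaks about functions satisfying IsMobius, so one is built here.
  -- μ[ k ] x y unfolds the recursion μ(x,y) = - Σ_{x ≤ z < y} μ(x,z) k times.
  μ[_] : ℕ → Elt K → Elt K → ℤ
  μ[ zero  ] x y = 0ℤ
  μ[ suc k ] x y with x ≟ y | x ≤? y
  ... | yes _ | _     = 1ℤ
  ... | no _  | yes _ = - sum (λ z → inHalfOpen x y z (μ[ k ] x z))
  ... | no _  | no _  = 0ℤ

  μ-fuel-irrelevant : ∀ k k′ x y → height y ℕ.< k → height y ℕ.< k′ → μ[ k ] x y ≡ μ[ k′ ] x y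
  μ-fuel-irrelevant (suc k) (suc k′) x y (s≤s y<k) (s≤s y<k′) with x ≟ y | x ≤? y
  ... | yes _ | _     = refl
  ... | no _  | no _  = refl
  ... | no _  | yes _ = cong -_ (sum-cong-≗ λ z → inHalfOpen-cong λ z⊏y →
    let z<y = height-mono z⊏y in
    μ-fuel-irrelevant k k′ x z (ℕ.<-≤-trans z<y y<k) (ℕ.<-≤-trans z<y y<k′))

  mobius : Elt K → Elt K → ℤ
  mobius x y = μ[ suc (height y) ] x y

  mobius-unfold : ∀ {x y} → x ⊏ y → mobius x y ≡ - sum (λ z → inHalfOpen x y z (μ[ height y ] x z))
  mobius-unfold {x} {y} (x≤y , x≢y) with x ≟ y | x ≤? y
  ... | yes x≡y | _     = ⊥-elim (x≢y x≡y)
  ... | no _    | no x≰y = ⊥-elim (x≰y x≤y)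
  ... | no _    | yes _  = refl

  mobius-isMobius : IsMobius K mobius
  mobius-isMobius = diagonal , off-interval , interval-sum
    where
    diagonal : ∀ x → mobius x x ≡ 1ℤ
    diagonal x with x ≟ x
    ... | yes _   = refl
    ... | no x≢x  = ⊥-elim (x≢x refl)

    off-interval : ∀ x y → ¬ (x ≤ y) → mobius x y ≡ 0ℤ
    off-interval x y x≰y with x ≟ y | x ≤? y
    ... | yes x≡y | _       = ⊥-elim (x≰y (reflexive x≡y))
    ... | no _    | yes x≤y = ⊥-elim (x≰y x≤y)
    ... | no _    | no _    = refl

    interval-sum : ∀ x y → x ⊏ y → ∑ K n (λ z → inInterval K x y z (mobius x z)) ≡ 0ℤ
    interval-sum x y x⊏y@(x≤y , _) = begin
      ∑ K n (λ z → inInterval K x y z (mobius x z))         ≡⟨ ∑≡sum K n _ ⟩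
      sum (λ z → inInterval K x y z (mobius x z))           ≡⟨ sum-interval-split (mobius x) x≤y ⟩
      mobius x y + sum (λ z → inHalfOpen x y z (mobius x z)) ≡⟨ cong (mobius x y +_) (sum-cong-≗ fuel) ⟩
      mobius x y + s                                        ≡⟨ cong (_+ s) (mobius-unfold x⊏y) ⟩
      - s + s                                               ≡⟨ +-inverseˡ s ⟩
      0ℤ                                                    ∎
      where
      s = sum (λ z → inHalfOpen x y z (μ[ height y ] x z))
      fuel : ∀ z → inHalfOpen x y z (mobius x z) ≡ inHalfOpen x y z (μ[ height y ] x z)
      fuel z = inHalfOpen-cong λ z⊏y →
        μ-fuel-irrelevant (suc (height z)) (height y) x z ℕ.≤-refl (height-mono z⊏y)

  mobius≡0-if-open-interval-has-maximum : ∀ {μ x p y} → IsMobius K μ → x ⊏ p → p ⊏ y →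
    (∀ z → x ⊏ z → z ⊏ y → z ≤ p) → μ x y ≡ 0ℤ
  mobius≡0-if-open-interval-has-maximum {μ} {x} {p} {y} (_ , _ , μ-sum) x⊏p@(x≤p , _) (p≤y , p≢y) below-p =
    begin
      μ x y                                         ≡⟨ sym (+-identityʳ _) ⟩
      μ x y + 0ℤ                                    ≡⟨ cong (μ x y +_) (sym halfOpen-sum≡0) ⟩
      μ x y + sum (λ z → inHalfOpen x y z (μ x z))  ≡⟨ sym (sum-interval-split (μ x) x≤y) ⟩
      sum (λ z → inInterval K x y z (μ x z))        ≡⟨ sym (∑≡sum K n _) ⟩
      ∑ K n (λ z → inInterval K x y z (μ x z))      ≡⟨ μ-sum x y x⊏y ⟩
      0ℤ                                            ∎
    where
    x⊏y = ⊏-≤-trans x⊏p p≤y p≢y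
    x≤y = ≤-trans x≤p p≤y
    [x,y⟩≡[x,p] : ∀ z v → inHalfOpen x y z v ≡ inInterval K x p z v
    [x,y⟩≡[x,p] z v with z ≟ y
    ... | yes refl = sym (inInterval-∉ v λ (_ , y≤p) → p≢y (antisym p≤y y≤p))
    ... | no z≢y   = inInterval-cong v
      (λ (x≤z , z≤y) → x≤z , ≤-p x≤z (z≤y , z≢y))
      (λ (x≤z , z≤p) → x≤z , ≤-trans z≤p p≤y)
      where
      ≤-p : x ≤ z → z ⊏ y → z ≤ p
      ≤-p x≤z z⊏y with x ≟ z
      ... | yes refl = x≤p
      ... | no x≢z   = below-p z (x≤z , x≢z) z⊏y
    halfOpen-sum≡0 : sum (λ z → inHalfOpen x y z (μ x z)) ≡ 0ℤ
    halfOpen-sum≡0 = begin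
      sum (λ z → inHalfOpen x y z (μ x z))      ≡⟨ sum-cong-≗ (λ z → [x,y⟩≡[x,p] z (μ x z)) ⟩
      sum (λ z → inInterval K x p z (μ x z))    ≡⟨ sym (∑≡sum K n _) ⟩
      ∑ K n (λ z → inInterval K x p z (μ x z))  ≡⟨ μ-sum x p x⊏p ⟩
      0ℤ                                        ∎

  eulerian-open-interval-has-no-maximum : ∀ {ρ x p y} → Eulerian K ρ → x ⊏ p → p ⊏ y →
    ¬ (∀ z → x ⊏ z → z ⊏ y → z ≤ p)
  eulerian-open-interval-has-no-maximum {ρ} {x} {p} {y} (_ , μ-sign) x⊏p@(x≤p , _) p⊏y@(p≤y , _) below-p =
    -1≢0 (i^n≡0⇒i≡0 -1ℤ (ρ y ℕ.∸ ρ x) (begin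
      -1ℤ ^ (ρ y ℕ.∸ ρ x)  ≡⟨ sym (μ-sign mobius mobius-isMobius x y (≤-trans x≤p p≤y)) ⟩
      mobius x y           ≡⟨ mobius≡0-if-open-interval-has-maximum mobius-isMobius x⊏p p⊏y below-p ⟩
      0ℤ                   ∎))
    where
    -1≢0 : -1ℤ ≢ 0ℤ
    -1≢0 ()

  PM-regressive : ∀ {M} → IsMatching K M → ∀ w → PM K M w ≤ w
  PM-regressive {M} (_ , covering) w with w ≤? M w | covering w
  ... | yes _   | _                     = ≤-refl
  ... | no _    | inj₁ ((Mw≤w , _) , _) = Mw≤w
  ... | no w≰Mw | inj₂ ((w≤Mw , _) , _) = ⊥-elim (w≰Mw w≤Mw)

  matching-irreflexive : ∀ {M} → IsMatching K M → ∀ w → M w ≢ w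
  matching-irreflexive (_ , covering) w with covering w
  ... | inj₁ ((_ , Mw≢w) , _) = Mw≢w
  ... | inj₂ ((_ , w≢Mw) , _) = w≢Mw ∘ sym

  PM-moves-top : ∀ {M t} → IsMatching K M → (∀ z → z ≤ t) → PM K M t ≢ t
  PM-moves-top {M} {t} M-matching t-max with t ≤? M t
  ... | yes t≤Mt = λ _ → matching-irreflexive M-matching t (antisym (t-max (M t)) t≤Mt)
  ... | no _     = matching-irreflexive M-matching t

  Generated-regressive : ∀ {f} → Generated K f → ∀ w → f w ≤ w
  Generated-regressive gen-id              w = ≤-refl
  Generated-regressive (gen-step {f = f} M-special g) w =
    ≤-trans (PM-regressive (proj₁ M-special) (f w)) (Generated-regressive g w)

  Generated-fixing-top-is-id : ∀ {f t} → Generated K f → (∀ z → z ≤ t) → f t ≡ t → ∀ w → f w ≡ w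
  Generated-fixing-top-is-id gen-id _ _ w = refl
  Generated-fixing-top-is-id {t = t} (gen-step {M} {f} (M-matching , _) g) t-max PMft≡t w =
    ⊥-elim (PM-moves-top M-matching t-max (subst (λ u → PM K M u ≡ t) ft≡t PMft≡t))
    where
    ft≡t : f t ≡ t
    ft≡t = antisym (Generated-regressive g t) (subst (_≤ f t) PMft≡t (PM-regressive M-matching (f t)))

  module _ {P : Elt K → Elt K} {z0 : Elt K} (P-regressive : ∀ x → P x ≤ x) where
    private
      S = ComplementWithBottom K P z0

    ComplementWithBottom-maximum : InMK K P → ∀ {t} → (∀ z → z ≤ t) → Σ (Elt K) λ b → S b × (∀ z → S z → z ≤ b)
    ComplementWithBottom-maximum (f , f-gen , P≗f) {t} t-max with P t ≟ t
    ... | no Pt≢t = t , inj₁ t∉Im , λ z _ → t-max z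
      where
      t∉Im : ¬ Im K P t
      t∉Im (a , Pa≡t) with antisym (t-max a) (subst (_≤ a) Pa≡t (P-regressive a))
      ... | refl = Pt≢t Pa≡t
    ... | yes Pt≡t = z0 , inj₂ refl , λ { z (inj₁ z∉Im) → ⊥-elim (z∉Im (z , P-id z)) ; z (inj₂ refl) → ≤-refl }
      where
      P-id : ∀ w → P w ≡ w
      P-id w = trans (P≗f w) (Generated-fixing-top-is-id f-gen t-max (trans (sym (P≗f t)) Pt≡t) w)

    ComplementWithBottom-cover⇒cover : ∀ {ρ x y} → IsMinimum K z0 → Eulerian K ρ →
      (∀ x y → x ≤ y → P x ≤ P y) → (∀ x → P (P x) ≡ P x) →
      S y → CoversIn K S x y → CoversIn K (λ _ → ⊤) x y
    ComplementWithBottom-cover⇒cover {_} {x} {y} z0-min eulerian P-mono P-idem Sy (x⊏y@(x≤y , x≢y) , nothing-in-S) =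
      x⊏y , nothing-between
      where
      y∉Im : ¬ Im K P y
      y∉Im = [ id , (λ { refl → ⊥-elim (x≢y (antisym x≤y (z0-min x))) }) ] Sy

      Py⊏y : P y ⊏ y
      Py⊏y = P-regressive y , λ Py≡y → y∉Im (y , Py≡y)

      between-≤Py : ∀ w → x ⊏ w → w ⊏ y → w ≤ P y
      between-≤Py w x⊏w w⊏y with P w ≟ w
      ... | yes Pw≡w = subst (_≤ P y) Pw≡w (P-mono w y (proj₁ w⊏y))
      ... | no Pw≢w  = ⊥-elim (nothing-in-S (w , inj₁ w∉Im , x⊏w , w⊏y))
        where
        w∉Im : ¬ Im K P w
        w∉Im (a , Pa≡w) = Pw≢w (trans (cong P (sym Pa≡w)) (trans (P-idem a) Pa≡w))

      nothing-between : ¬ Σ (Elt K) λ w → ⊤ × x ⊏ w × w ⊏ y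
      nothing-between (w , _ , x⊏w@(x≤w , x≢w) , w⊏y) with x ≟ P y
      ... | yes x≡Py = x≢w (antisym x≤w (subst (w ≤_) (sym x≡Py) (between-≤Py w x⊏w w⊏y)))
      ... | no x≢Py  = eulerian-open-interval-has-no-maximum eulerian
        (≤-trans x≤w (between-≤Py w x⊏w w⊏y) , x≢Py) Py⊏y between-≤Py

theorem4p12 : (K : FinPoset) (ρ : Fin (FinPoset.n K) → ℕ) (z0 : Fin (FinPoset.n K)) →
    IsMinimum K z0 → Eulerian K ρ →
    (P : Fin (FinPoset.n K) → Fin (FinPoset.n K)) → IsSpecialProjection K P →
    GradedOn K (ComplementWithBottom K P z0) ρ
theorem4p12 K ρ z0 z0-min eulerian@((_ , (t , _ , t-max) , ρ-covers) , _) P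
            (((P-mono , P-regressive) , P-idem , _) , P∈MK) =
  (z0 , inj₂ refl , λ z _ → z0-min z) ,
  ComplementWithBottom-maximum K P-regressive P∈MK (λ z → t-max z tt) ,
  λ x y _ Sy x⋖y → ρ-covers x y tt tt
    (ComplementWithBottom-cover⇒cover K P-regressive z0-min eulerian P-mono P-idem Sy x⋖y)
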